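{- Assume the Diagonal Conjecture (DC) holds. If $\lim_{r\to\infty} R_r(3)^{1/r}$ is finite, then $\lim_{r\to\infty} R_r(k)^{1/r}$ is finite for every integer $k \ge 3$.
   Context: For integers $k_1,\dots,k_m \ge 2$, the multicolor Ramsey number $R(k_1,\dots,k_m)$ is the least $n$ such that every coloring of the edges of $K_n$ with $m$ colors contains, for some $i$, a $K_{k_i}$ all of whose edges have color $i$; it is symmetric in its arguments. $R_m(k)$ denotes $R(k,\dots,k)$ with $m$ arguments. For each $k\ge 3$ the limit $\lim_{r\to\infty} R_r(k)^{1/r}$ exists (possibly infinite). DC (the Diagonal Conjecture, multicolor form) is the assertion: for all integers $3 \le s \le t$ and any integers $k_3,\dots,k_m \ge 2$, $R(s,t,k_3,\dots,k_m) \ge R(s-1,t+1,k_3,\dots,k_m)$. -}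

module Defs where

open import Data.Nat using (ℕ; zero; suc; pred; _≤_; _<_; _^_)
open import Data.Fin using (Fin) renaming (_<_ to _<ᶠ_)
open import Data.List using (List; _∷_; length; lookup; replicate)
open import Data.List.Relation.Unary.All using (All)
open import Data.Product using (Σ; ∃; _×_)
open import Relation.Binary.PropositionalEquality using (_≡_)
open import Relation.Nullary using (¬_)

-- An m-colouring of the edges of K_n.  The edge {i,j} with i < j gets
-- colour c i j; values c i j with i ≥ j are irrelevant.
Colouring : ℕ → ℕ → Set
Colouring n m = Fin n → Fin n → Fin m

MonoClique : ∀ {n m} → Colouring n m → ℕ → Fin m → Set
MonoClique {n} c k col =
  Σ (Fin k → Fin n) λ f →
    (∀ a b → a <ᶠ b → f a <ᶠ f b) ×
    (∀ a b → a <ᶠ b → c (f a) (f b) ≡ col)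

Arrows : ℕ → List ℕ → Set
Arrows n ks = (c : Colouring n (length ks)) →
  ∃ λ (i : Fin (length ks)) → MonoClique c (lookup ks i) i

IsRamsey : List ℕ → ℕ → Set
IsRamsey ks n = Arrows n ks × (∀ n' → n' < n → ¬ Arrows n' ks)

DC : Set
DC = ∀ s t → 3 ≤ s → s ≤ t → (ks : List ℕ) → All (2 ≤_) ks →
     ∀ a b → IsRamsey (s ∷ t ∷ ks) a → IsRamsey (pred s ∷ suc t ∷ ks) b →
     b ≤ a

-- lim_{r→∞} R_r(k)^{1/r} is finite  (the limit is known to exist):
-- there is C with R_r(k) ≤ C^r for all r ≥ 1.
FiniteGrowth : ℕ → Set
FiniteGrowth k = ∃ λ (C : ℕ) → ∀ r → 1 ≤ r → ∀ n →
  IsRamsey (replicate r k) n → n ≤ C ^ r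

-- With s = 3, DC says R(2, t+1, ks) ≤ R(3, t, ks), and R(2, t+1, ks) = R(t+1, ks)
-- because a colour asking only for an edge can be merged away.  Since Ramsey numbers
-- are symmetric in their arguments, iterating this k − 3 times on each argument gives
-- R_r(k) ≤ R_{(k−2)r}(3) ≤ C^{(k−2)r} = (C^{k−2})^r.  DC only compares Ramsey numbers
-- that exist, so the chain also needs every R(ks) to exist: the finite Ramsey theorem
-- gives some n → ks, and arrowing is decidable, so there is a least one.
module Submission where

open import Defs
import Algebra.Properties.CommutativeMonoid.Sum as Sum
open import Level using (0ℓ)
open import Data.Nat
  using (ℕ; zero; suc; pred; _+_; _*_; _^_; _≤_; _<_; z≤n; s≤s; _≟_; NonZero; ≢-nonZero)
import Data.Nat.Properties
open Data.Nat.Properties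
  using ( +-0-commutativeMonoid; +-suc; suc-pred; suc-injective; m+n≡0⇒m≡0; +-mono-≤; +-mono-<-≤
        ; _≤?_; ≤-refl; ≤-trans; ≤-reflexive; <⇒≤; <⇒≱; ≰⇒>; ≮⇒≥; n<1+n; m<n⇒m<1+n
        ; m<1+n⇒m<n∨m≡n; m≤m+n; *-comm; ^-*-assoc)
open import Data.Fin using (Fin; zero; suc) renaming (_<_ to _<ᶠ_; _≟_ to _≟ᶠ_)
open import Data.Fin.Properties using (any?; all?; _<?_; ¬Fin0) renaming (suc-injective to sucᶠ-injective)
open import Data.Fin.Permutation using (Permutation; _⟨$⟩ʳ_; _⟨$⟩ˡ_; inverseʳ)
open import Data.Vec.Functional using (Vector; head; tail; updateAt) renaming (_∷_ to _∷ᵛ_)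
open import Data.Vec.Functional.Properties using (updateAt-updates; updateAt-minimal)
open import Data.Vec.Functional.Relation.Binary.Pointwise using (Pointwise)
open import Data.List using (List; []; _∷_; _++_; length; lookup; filter; replicate; allFin)
open import Data.List.Properties using (length-tabulate; ++-assoc; ++-identityʳ)
open import Data.List.Relation.Unary.All as All using (All; []; _∷_)
open import Data.List.Relation.Unary.All.Properties using (++⁺; replicate⁺)
open import Data.List.Relation.Unary.AllPairs using (AllPairs; []; _∷_)
open import Data.List.Relation.Unary.AllPairs.Properties using (filter⁺; tabulate⁺-<)
open import Data.List.Relation.Unary.Any using (here; there)
open import Data.List.Relation.Binary.Subset.Propositional using (_⊆_)
open import Data.List.Membership.Propositional using (_∈_)
open import Data.List.Membership.Propositional.Properties using (∈-filter⁻; ∈-lookup)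
open import Data.Empty using (⊥-elim)
open import Data.Product using (∃; ∃₂; _×_; _,_; proj₁; proj₂)
open import Data.Sum using (_⊎_; inj₁; inj₂; [_,_]′)
open import Function using (id; _∘_; _⇔_; mk⇔; Equivalence)
open import Relation.Binary using (Rel; Reflexive; Symmetric; _Respects_; Preorder)
open import Relation.Unary using (Pred; Decidable)
open import Relation.Nullary using (Dec; yes; no; ¬_; ¬?)
open import Relation.Nullary.Decidable using (map′; _×-dec_; _→-dec_; decidable-stable)
open import Relation.Binary.PropositionalEquality
  using ( _≡_; _≢_; refl; sym; trans; cong; cong₂; subst; subst₂; setoid; isEquivalence
        ; module ≡-Reasoning)
open import Data.List.Relation.Binary.Permutation.Setoid (setoid ℕ)
  using (_↭_; ↭-sym; ↭-swap; ↭-refl; onIndices)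
open import Data.List.Relation.Binary.Permutation.Setoid.Properties (setoid ℕ)
  using (onIndices-lookup; ↭-shift; shifts)

open Sum +-0-commutativeMonoid using (sum; sum-cong-≗; sum-replicate-zero)

sum-updateAt-suc : ∀ {m} (K : Vector ℕ m) i → sum (updateAt K i suc) ≡ suc (sum K)
sum-updateAt-suc K zero = refl
sum-updateAt-suc K (suc i) = trans (cong (K zero +_) (sum-updateAt-suc (tail K) i)) (+-suc _ _)

sum-updateAt-pred : ∀ {m} (K : Vector ℕ m) i .{{_ : NonZero (K i)}} → suc (sum (updateAt K i pred)) ≡ sum K
sum-updateAt-pred K zero = cong (_+ sum (tail K)) (suc-pred (K zero))
sum-updateAt-pred K (suc i) = trans (sym (+-suc _ _)) (cong (K zero +_) (sum-updateAt-pred (tail K) i))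

sum-mono-≤ : ∀ {m} {A B : Vector ℕ m} → (∀ i → A i ≤ B i) → sum A ≤ sum B
sum-mono-≤ {zero} A≤B = z≤n
sum-mono-≤ {suc m} A≤B = +-mono-≤ (A≤B zero) (sum-mono-≤ (λ i → A≤B (suc i)))

pigeonhole-sum : ∀ {m} (A B : Vector ℕ (suc m)) → sum A ≤ sum B → ∃ λ i → A i ≤ B i
pigeonhole-sum A B ∑A≤∑B with any? (λ i → A i ≤? B i)
... | yes A≤B = A≤B
... | no ¬A≤B = ⊥-elim (<⇒≱ ∑B<∑A ∑A≤∑B)
  where
  B<A : ∀ i → B i < A i
  B<A i = ≰⇒> λ A≤B → ¬A≤B (i , A≤B)
  ∑B<∑A : sum B < sum A
  ∑B<∑A = +-mono-<-≤ (B<A zero) (sum-mono-≤ λ i → <⇒≤ (B<A (suc i)))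

colourCount : ∀ {n m} → (Fin n → Fin m) → List (Fin n) → Vector ℕ m
colourCount g xs j = length (filter (λ y → g y ≟ᶠ j) xs)

colourCount-∷ : ∀ {n m} (g : Fin n → Fin m) y ys j →
                colourCount g (y ∷ ys) j ≡ updateAt (colourCount g ys) (g y) suc j
colourCount-∷ g y ys j with g y ≟ᶠ j
... | yes refl = sym (updateAt-updates (g y) (colourCount g ys))
... | no gy≢j = sym (updateAt-minimal j (g y) (colourCount g ys) (gy≢j ∘ sym))

sum-colourCount : ∀ {n m} (g : Fin n → Fin m) xs → sum (colourCount g xs) ≡ length xs
sum-colourCount {m = m} g [] = sum-replicate-zero m
sum-colourCount g (y ∷ ys) = begin
  sum (colourCount g (y ∷ ys))                     ≡⟨ sum-cong-≗ (colourCount-∷ g y ys) ⟩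
  sum (updateAt (colourCount g ys) (g y) suc)      ≡⟨ sum-updateAt-suc (colourCount g ys) (g y) ⟩
  suc (sum (colourCount g ys))                     ≡⟨ cong suc (sum-colourCount g ys) ⟩
  suc (length ys)                                  ∎
  where open ≡-Reasoning

Increasing : ∀ {n} → List (Fin n) → Set
Increasing = AllPairs _<ᶠ_

MonoCliqueList : ∀ {n m} → Colouring n m → Fin m → List (Fin n) → Set
MonoCliqueList c col = AllPairs (λ u v → u <ᶠ v × c u v ≡ col)

AllPairs-lookup : ∀ {A : Set} {R : A → A → Set} {xs : List A} → AllPairs R xs →
                  ∀ {i j} → i <ᶠ j → R (lookup xs i) (lookup xs j)
AllPairs-lookup (Rx ∷ _) {zero} {suc j} _ = All.lookup Rx (∈-lookup j)
AllPairs-lookup (_ ∷ Rxs) {suc i} {suc j} (s≤s i<j) = AllPairs-lookup Rxs i<j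

MonoCliqueList⇒MonoClique : ∀ {n m} {c : Colouring n m} {col ys} →
                            MonoCliqueList c col ys → MonoClique c (length ys) col
MonoCliqueList⇒MonoClique {ys = ys} clique =
  lookup ys , (λ _ _ → proj₁ ∘ AllPairs-lookup clique) , (λ _ _ → proj₂ ∘ AllPairs-lookup clique)

-- R(K) ≤ N, strengthened (the clique is found inside any increasing list of
-- vertices) so that it can be proved by induction on ∑ K.
RamseyBound : ∀ {m} → Vector ℕ m → ℕ → Set
RamseyBound {m} K N = ∀ {n} (c : Colouring n m) (xs : List (Fin n)) → Increasing xs → N ≤ length xs →
  ∃₂ λ i ys → ys ⊆ xs × MonoCliqueList c i ys × length ys ≡ K i

RamseyBound-step : ∀ {m} (K : Vector ℕ (suc m)) .{{_ : ∀ {i} → NonZero (K i)}} (N : Vector ℕ (suc m)) →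
                   (∀ i → RamseyBound (updateAt K i pred) (N i)) → RamseyBound K (suc (sum N))
RamseyBound-step K N bound c (x ∷ rest) (x<rest ∷ rest↑) (s≤s ∑N≤rest)
  with i , Nᵢ≤ ← pigeonhole-sum N (colourCount (c x) rest)
                   (≤-trans ∑N≤rest (≤-reflexive (sym (sum-colourCount (c x) rest))))
  with j , ys , ys⊆ , clique , |ys|
         ← bound i c (filter (λ y → c x y ≟ᶠ i) rest) (filter⁺ _ rest↑) Nᵢ≤
  with j ≟ᶠ i
... | no j≢i = j , ys , there ∘ proj₁ ∘ ∈-filter⁻ _ ∘ ys⊆ , clique ,
               trans |ys| (updateAt-minimal j i K j≢i)
... | yes refl = j , x ∷ ys , ∷⊆ , All.tabulate x-joins ∷ clique ,
                 trans (cong suc (trans |ys| (updateAt-updates j K))) (suc-pred (K j))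
  where
  ∷⊆ : x ∷ ys ⊆ x ∷ rest
  ∷⊆ (here refl) = here refl
  ∷⊆ (there y∈ys) = there (proj₁ (∈-filter⁻ _ (ys⊆ y∈ys)))
  x-joins : ∀ {y} → y ∈ ys → x <ᶠ y × c x y ≡ j
  x-joins y∈ys with y∈rest , cxy≡j ← ∈-filter⁻ _ (ys⊆ y∈ys) = All.lookup x<rest y∈rest , cxy≡j

ramseyBound : ∀ {m} (K : Vector ℕ m) → ∃ (RamseyBound K)
ramseyBound K = go (sum K) K refl
  where
  go : ∀ {m} s (K : Vector ℕ m) → sum K ≡ s → ∃ (RamseyBound K)
  go {zero} _ K _ = 1 , λ { c (x ∷ _) _ _ → ⊥-elim (¬Fin0 (c x x)) }
  go {suc m} s K ∑K≡s with any? (λ i → K i ≟ 0)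
  ... | yes (i , Kᵢ≡0) = 0 , λ _ _ _ _ → i , [] , (λ ()) , [] , sym Kᵢ≡0
  go {suc m} zero K ∑K≡0 | no K≢0 = ⊥-elim (K≢0 (zero , m+n≡0⇒m≡0 (K zero) ∑K≡0))
  go {suc m} (suc s) K ∑K≡1+s | no K≢0 = suc (sum N) , RamseyBound-step K N (proj₂ ∘ smaller)
    where
    instance
      K-nonZero : ∀ {i} → NonZero (K i)
      K-nonZero {i} = ≢-nonZero (λ Kᵢ≡0 → K≢0 (i , Kᵢ≡0))
    smaller : ∀ i → ∃ (RamseyBound (updateAt K i pred))
    smaller i = go s (updateAt K i pred) (suc-injective (trans (sum-updateAt-pred K i) ∑K≡1+s))
    N : Vector ℕ (suc m)
    N = proj₁ ∘ smaller

Arrows-satisfiable : ∀ ks → ∃ λ N → Arrows N ks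
Arrows-satisfiable ks with N , bound ← ramseyBound (lookup ks) = N , λ c →
  let i , ys , _ , clique , |ys| = bound c (allFin N) (tabulate⁺-< id) (≤-reflexive (sym (length-tabulate id)))
  in i , subst (λ k → MonoClique c k i) |ys| (MonoCliqueList⇒MonoClique clique)

-- Without function extensionality, searching a function space only works for
-- predicates that respect pointwise equality, hence the relation.
Exhaustible : (A : Set) → Rel A 0ℓ → Set₁
Exhaustible A _≈_ = ∀ {P : Pred A 0ℓ} → P Respects _≈_ → Decidable P → Dec (∃ P)

Fin-exhaustible : ∀ {n} → Exhaustible (Fin n) _≡_
Fin-exhaustible _ = any?

Vector-exhaustible : ∀ {A _≈_} → Reflexive _≈_ → Exhaustible A _≈_ →
                     ∀ {k} → Exhaustible (Vector A k) (Pointwise _≈_)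
Vector-exhaustible refl≈ exh {zero} resp P? with P? (λ ())
... | yes P[] = yes (_ , P[])
... | no ¬P[] = no λ (xs , Pxs) → ¬P[] (resp (λ ()) Pxs)
Vector-exhaustible {A} {_≈_} refl≈ exh {suc k} {P} resp P? =
  map′ (λ (x , xs , Px∷ᵛxs) → x ∷ᵛ xs , Px∷ᵛxs)
       (λ (xs , Pxs) → head xs , tail xs , resp head∷tail≈ Pxs)
       (exh extends-resp extends?)
  where
  head∷tail≈ : ∀ {xs : Vector A (suc k)} → Pointwise _≈_ xs (head xs ∷ᵛ tail xs)
  head∷tail≈ zero = refl≈
  head∷tail≈ (suc i) = refl≈
  extends : Pred A 0ℓ
  extends x = ∃ λ xs → P (x ∷ᵛ xs)
  extends-resp : extends Respects _≈_
  extends-resp x≈y (xs , Px∷ᵛxs) = xs , resp (λ { zero → x≈y ; (suc i) → refl≈ }) Px∷ᵛxs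
  extends? : Decidable extends
  extends? x = Vector-exhaustible refl≈ exh
    (λ xs≈ys → resp λ { zero → refl≈ ; (suc i) → xs≈ys i }) (P? ∘ (x ∷ᵛ_))

Exhaustible⇒∀-dec : ∀ {A _≈_} → Symmetric _≈_ → Exhaustible A _≈_ →
                    ∀ {P : Pred A 0ℓ} → P Respects _≈_ → Decidable P → Dec (∀ x → P x)
Exhaustible⇒∀-dec sym≈ exh resp P? with exh (λ x≈y ¬Px Py → ¬Px (resp (sym≈ x≈y) Py)) (¬? ∘ P?)
... | yes (x , ¬Px) = no λ ∀P → ¬Px (∀P x)
... | no ∄¬P = yes λ x → decidable-stable (P? x) λ ¬Px → ∄¬P (x , ¬Px)

MonoClique-dec : ∀ {n m} (c : Colouring n m) k col → Dec (MonoClique c k col)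
MonoClique-dec {n} c k col = Vector-exhaustible refl Fin-exhaustible resp clique?
  where
  IsClique : Pred (Vector (Fin n) k) 0ℓ
  IsClique f = (∀ a b → a <ᶠ b → f a <ᶠ f b) × (∀ a b → a <ᶠ b → c (f a) (f b) ≡ col)
  resp : IsClique Respects Pointwise _≡_
  resp f≗g (f↑ , f-col) =
    (λ a b a<b → subst₂ _<ᶠ_ (f≗g a) (f≗g b) (f↑ a b a<b)) ,
    (λ a b a<b → trans (sym (cong₂ c (f≗g a) (f≗g b))) (f-col a b a<b))
  clique? : Decidable IsClique
  clique? f = all? (λ a → all? λ b → (a <? b) →-dec (f a <? f b)) ×-dec
              all? (λ a → all? λ b → (a <? b) →-dec (c (f a) (f b) ≟ᶠ col))

Arrows-dec : ∀ n ks → Dec (Arrows n ks)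
Arrows-dec n ks =
  Exhaustible⇒∀-dec (λ c≈d u v → sym (c≈d u v))
    (Vector-exhaustible (λ _ → refl) (Vector-exhaustible refl Fin-exhaustible))
    (λ c≈d (i , f , f↑ , f-col) →
      i , f , f↑ , λ a b a<b → trans (sym (c≈d (f a) (f b))) (f-col a b a<b))
    (λ c → any? λ i → MonoClique-dec c (lookup ks i) i)

least-below : ∀ {P : Pred ℕ 0ℓ} → Decidable P → ∀ N →
              (∃ λ n → n < N × P n × (∀ m → m < n → ¬ P m)) ⊎ (∀ m → m < N → ¬ P m)
least-below P? zero = inj₂ λ _ ()
least-below P? (suc N) with least-below P? N
... | inj₁ (n , n<N , Pn , least) = inj₁ (n , m<n⇒m<1+n n<N , Pn , least)
... | inj₂ none with P? N
...   | yes PN = inj₁ (N , n<1+n N , PN , none)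
...   | no ¬PN = inj₂ λ m m<1+N → [ none m , (λ { refl → ¬PN }) ]′ (m<1+n⇒m<n∨m≡n m<1+N)

least-witness : ∀ {P : Pred ℕ 0ℓ} → Decidable P → ∃ P →
                ∃ λ n → P n × (∀ m → m < n → ¬ P m)
least-witness P? (N , PN) with least-below P? N
... | inj₁ (n , _ , Pn , least) = n , Pn , least
... | inj₂ none = N , PN , none

IsRamsey-exists : ∀ ks → ∃ (IsRamsey ks)
IsRamsey-exists ks = least-witness (λ n → Arrows-dec n ks) (Arrows-satisfiable ks)

Arrows-↭ : ∀ {n xs ys} → xs ↭ ys → Arrows n xs → Arrows n ys
Arrows-↭ {xs = xs} {ys} p arrows c = transport (arrows (λ u v → π ⟨$⟩ˡ c u v))
  where
  π : Permutation (length xs) (length ys)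
  π = onIndices p
  transport : ∃ (λ i → MonoClique (λ u v → π ⟨$⟩ˡ c u v) (lookup xs i) i) →
              ∃ λ j → MonoClique c (lookup ys j) j
  transport (i , f , f↑ , f-col) =
    π ⟨$⟩ʳ i , subst (λ k → MonoClique c k (π ⟨$⟩ʳ i)) (onIndices-lookup p i)
                     (f , f↑ , λ a b a<b → trans (sym (inverseʳ π)) (cong (π ⟨$⟩ʳ_) (f-col a b a<b)))

-- The colour k is needed: R(2) = 2 but R() = 1.
Arrows-2∷ : ∀ {n} k ks → Arrows n (k ∷ ks) ⇔ Arrows n (2 ∷ k ∷ ks)
Arrows-2∷ {n} k ks = mk⇔ add2 drop2
  where
  m : ℕ
  m = length ks
  drop2 : Arrows n (2 ∷ k ∷ ks) → Arrows n (k ∷ ks)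
  drop2 arrows c with arrows (λ u v → suc (c u v))
  ... | zero , _ , _ , f-col with () ← f-col zero (suc zero) (s≤s z≤n)
  ... | suc i , f , f↑ , f-col = i , f , f↑ , λ a b a<b → sucᶠ-injective (f-col a b a<b)

  edge : ∀ {c : Colouring n (suc (suc m))} {u v} → u <ᶠ v → c u v ≡ zero → MonoClique c 2 zero
  edge {c} {u} {v} u<v cuv≡0 = ends , ends↑ , ends-col
    where
    ends : Fin 2 → Fin n
    ends zero = u
    ends (suc _) = v
    ends↑ : ∀ a b → a <ᶠ b → ends a <ᶠ ends b
    ends↑ zero (suc zero) _ = u<v
    ends↑ (suc zero) (suc zero) (s≤s ())
    ends-col : ∀ a b → a <ᶠ b → c (ends a) (ends b) ≡ zero
    ends-col zero (suc zero) _ = cuv≡0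
    ends-col (suc zero) (suc zero) (s≤s ())

  -- Merging colours 0 and 1 is harmless once no edge has colour 0.
  merge₀₁ : Fin (suc (suc m)) → Fin (suc m)
  merge₀₁ zero = zero
  merge₀₁ (suc j) = j

  unmerge : ∀ {j i} → j ≢ zero → merge₀₁ j ≡ i → j ≡ suc i
  unmerge {zero} j≢0 _ = ⊥-elim (j≢0 refl)
  unmerge {suc j} _ refl = refl

  add2 : Arrows n (k ∷ ks) → Arrows n (2 ∷ k ∷ ks)
  add2 arrows c with any? (λ u → any? (λ v → (u <? v) ×-dec (c u v ≟ᶠ zero)))
  ... | yes (u , v , u<v , cuv≡0) = zero , edge u<v cuv≡0
  ... | no no-edge₀ with i , f , f↑ , f-col ← arrows (λ u v → merge₀₁ (c u v)) =
    suc i , f , f↑ , λ a b a<b →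
      unmerge (λ cfafb≡0 → no-edge₀ (f a , f b , f↑ a b a<b , cfafb≡0)) (f-col a b a<b)

IsRamsey-minimal : ∀ {ks a b} → IsRamsey ks a → Arrows b ks → a ≤ b
IsRamsey-minimal (_ , minimal) arrows = ≮⇒≥ λ b<a → minimal _ b<a arrows

IsRamsey-cong : ∀ {xs ys a} → (∀ {n} → Arrows n xs ⇔ Arrows n ys) → IsRamsey xs a → IsRamsey ys a
IsRamsey-cong xs⇔ys (arrows , minimal) =
  Equivalence.to xs⇔ys arrows , λ n n<a → minimal n n<a ∘ Equivalence.from xs⇔ys

record _≤ᴿ_ (xs ys : List ℕ) : Set where
  constructor mk≤ᴿ
  field ramsey-≤ : ∀ {a b} → IsRamsey xs a → IsRamsey ys b → a ≤ b
open _≤ᴿ_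

≤ᴿ-reflexive : ∀ {xs ys} → xs ≡ ys → xs ≤ᴿ ys
≤ᴿ-reflexive {xs} refl = mk≤ᴿ λ Rxs (arrows , _) → IsRamsey-minimal {xs} Rxs arrows

≤ᴿ-trans : ∀ {xs ys zs} → xs ≤ᴿ ys → ys ≤ᴿ zs → xs ≤ᴿ zs
≤ᴿ-trans {ys = ys} xs≤ys ys≤zs with b , Rys ← IsRamsey-exists ys =
  mk≤ᴿ λ Rxs Rzs → ≤-trans (ramsey-≤ xs≤ys Rxs Rys) (ramsey-≤ ys≤zs Rys Rzs)

≤ᴿ-preorder : Preorder 0ℓ 0ℓ 0ℓ
≤ᴿ-preorder = record
  { Carrier = List ℕ ; _≈_ = _≡_ ; _≲_ = _≤ᴿ_
  ; isPreorder = record { isEquivalence = isEquivalence ; reflexive = ≤ᴿ-reflexive ; trans = ≤ᴿ-trans } }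

↭⇒≤ᴿ : ∀ {xs ys} → xs ↭ ys → xs ≤ᴿ ys
↭⇒≤ᴿ {xs} p = mk≤ᴿ λ Rxs (arrows , _) → IsRamsey-minimal {xs} Rxs (Arrows-↭ (↭-sym p) arrows)

dc-step : DC → ∀ {t ks} → 3 ≤ t → All (2 ≤_) ks → (suc t ∷ ks) ≤ᴿ (3 ∷ t ∷ ks)
dc-step dc {t} {ks} 3≤t ks≥2 =
  mk≤ᴿ λ R[t+1,ks] R[3,t,ks] →
    dc 3 t ≤-refl 3≤t ks ks≥2 _ _ R[3,t,ks] (IsRamsey-cong (Arrows-2∷ (suc t) ks) R[t+1,ks])

replicate-+ : ∀ {A : Set} m n (x : A) → replicate (m + n) x ≡ replicate m x ++ replicate n x
replicate-+ zero n x = refl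
replicate-+ (suc m) n x = cong (x ∷_) (replicate-+ m n x)

module _ (dc : DC) where
  open import Relation.Binary.Reasoning.Preorder ≤ᴿ-preorder

  split-into-threes : ∀ d ks → All (2 ≤_) ks → (3 + d ∷ ks) ≤ᴿ (replicate (suc d) 3 ++ ks)
  split-into-threes zero ks _ = ≤ᴿ-reflexive refl
  split-into-threes (suc d) ks ks≥2 = begin
    4 + d ∷ ks                     ≲⟨ dc-step dc (m≤m+n 3 d) ks≥2 ⟩
    3 ∷ 3 + d ∷ ks                 ≲⟨ ↭⇒≤ᴿ (↭-swap 3 (3 + d) ↭-refl) ⟩
    3 + d ∷ 3 ∷ ks                 ≲⟨ split-into-threes d (3 ∷ ks) (m≤m+n 2 1 ∷ ks≥2) ⟩
    replicate (suc d) 3 ++ 3 ∷ ks  ≲⟨ ↭⇒≤ᴿ (↭-shift (replicate (suc d) 3) ks) ⟩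
    replicate (2 + d) 3 ++ ks      ∎

  replicate-split-into-threes : ∀ d q ks → All (2 ≤_) ks →
                                (replicate q (3 + d) ++ ks) ≤ᴿ (replicate (q * suc d) 3 ++ ks)
  replicate-split-into-threes d zero ks _ = ≤ᴿ-reflexive refl
  replicate-split-into-threes d (suc q) ks ks≥2 = begin
    3 + d ∷ ks′                               ≲⟨ split-into-threes d ks′ ks′≥2 ⟩
    threes ++ ks′                             ≲⟨ ↭⇒≤ᴿ (shifts threes (replicate q (3 + d))) ⟩
    replicate q (3 + d) ++ threes ++ ks       ≲⟨ replicate-split-into-threes d q (threes ++ ks) threes++ks≥2 ⟩
    replicate (q * suc d) 3 ++ threes ++ ks   ≲⟨ ↭⇒≤ᴿ (shifts (replicate (q * suc d) 3) threes) ⟩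
    threes ++ replicate (q * suc d) 3 ++ ks   ≡⟨ ++-assoc threes _ ks ⟨
    (threes ++ replicate (q * suc d) 3) ++ ks ≡⟨ cong (_++ ks) (replicate-+ (suc d) (q * suc d) 3) ⟨
    replicate (suc q * suc d) 3 ++ ks         ∎
    where
    threes : List ℕ
    threes = replicate (suc d) 3
    ks′ : List ℕ
    ks′ = replicate q (3 + d) ++ ks
    ks′≥2 : All (2 ≤_) ks′
    ks′≥2 = ++⁺ (replicate⁺ q (m≤m+n 2 (suc d))) ks≥2
    threes++ks≥2 : All (2 ≤_) (threes ++ ks)
    threes++ks≥2 = ++⁺ (replicate⁺ (suc d) (m≤m+n 2 1)) ks≥2

theorem2 : DC → FiniteGrowth 3 → (k : ℕ) → 3 ≤ k → FiniteGrowth k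
theorem2 dc (C , R₃-bound) (suc (suc (suc d))) (s≤s (s≤s (s≤s z≤n))) = C ^ suc d , Rₖ-bound
  where
  Rₖ-bound : ∀ r → 1 ≤ r → ∀ n → IsRamsey (replicate r (3 + d)) n → n ≤ (C ^ suc d) ^ r
  Rₖ-bound r@(suc _) (s≤s z≤n) n Rₖ = begin
    n                 ≤⟨ ramsey-≤ Rₖ≤R₃ Rₖ R₃ ⟩
    m                 ≤⟨ R₃-bound (r * suc d) (s≤s z≤n) m R₃ ⟩
    C ^ (r * suc d)   ≡⟨ cong (C ^_) (*-comm r (suc d)) ⟩
    C ^ (suc d * r)   ≡⟨ ^-*-assoc C (suc d) r ⟨
    (C ^ suc d) ^ r   ∎
    where
    open Data.Nat.Properties.≤-Reasoning
    m : ℕ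
    m = proj₁ (IsRamsey-exists (replicate (r * suc d) 3))
    R₃ : IsRamsey (replicate (r * suc d) 3) m
    R₃ = proj₂ (IsRamsey-exists (replicate (r * suc d) 3))
    Rₖ≤R₃ : replicate r (3 + d) ≤ᴿ replicate (r * suc d) 3
    Rₖ≤R₃ = subst₂ _≤ᴿ_ (++-identityʳ _) (++-identityʳ _) (replicate-split-into-threes dc d r [] [])
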